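{- Let $G$ be a graph, let $A\subseteq V(G)$ be an independent set with $|A|=\alpha(G)$, and let $M$ be a matching in $G$ each of whose edges has one end in $V(G)\setminus A$ and the other in $A$, chosen with $|M|$ as large as possible among such matchings. Let $G'$ be the graph obtained from $G$ by deleting all edges incident with vertices of $A\setminus V(M)$. Then $\alpha(G')=\alpha(G)$.
   Context: $\alpha(G)$ denotes the independence number of $G$; $V(M)$ is the set of vertices covered by $M$. -}

module Defs where

open import Data.Nat using (ℕ; _≤_)
open import Data.Fin using (Fin) renaming (_≟_ to _≟ᶠ_)
open import Data.Fin.Subset using (Subset; _∈_; _∉_; ∣_∣)
open import Data.Fin.Subset.Properties using () renaming (_∈?_ to _∈ˢ?_)
open import Data.List using (List; []; _∷_; length; concatMap)
open import Data.List.Relation.Unary.All using (All)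
open import Data.List.Relation.Unary.Unique.Propositional using (Unique)
import Data.List.Membership.DecPropositional as DecMem
open import Data.Product using (_×_; _,_; ∃; proj₁; proj₂)
open import Relation.Nullary using (¬_; Dec; yes; no)
open import Relation.Nullary.Decidable using (_×-dec_; ¬?)
open import Relation.Binary using (Decidable)
open import Relation.Binary.PropositionalEquality using (_≡_)

record Graph (n : ℕ) : Set₁ where
  field
    Adj   : Fin n → Fin n → Set
    sym   : ∀ {u v} → Adj u v → Adj v u
    irrefl : ∀ {u} → ¬ Adj u u
    adj?  : Decidable Adj
open Graph public

module _ {n : ℕ} where

  open DecMem (_≟ᶠ_ {n}) using () renaming (_∈_ to _∈ˡ_; _∈?_ to _∈ˡ?_)

  Independent : Graph n → Subset n → Set
  Independent G S = ∀ u v → u ∈ S → v ∈ S → ¬ Adj G u v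

  IsIndependenceNumber : Graph n → ℕ → Set
  IsIndependenceNumber G k =
    (∃ λ S → Independent G S × ∣ S ∣ ≡ k) × (∀ S → Independent G S → ∣ S ∣ ≤ k)

  Edges : Set
  Edges = List (Fin n × Fin n)

  verts : Edges → List (Fin n)
  verts = concatMap (λ e → proj₁ e ∷ proj₂ e ∷ [])

  CrossMatching : Graph n → Subset n → Edges → Set
  CrossMatching G A M =
    All (λ e → Adj G (proj₁ e) (proj₂ e) × proj₁ e ∉ A × proj₂ e ∈ A) M
    × Unique (verts M)

  MaximumCrossMatching : Graph n → Subset n → Edges → Set
  MaximumCrossMatching G A M =
    CrossMatching G A M × (∀ M' → CrossMatching G A M' → length M' ≤ length M)

  Deleted : Subset n → Edges → Fin n → Set
  Deleted A M x = x ∈ A × ¬ (x ∈ˡ verts M)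

  Deleted? : (A : Subset n) (M : Edges) → (x : Fin n) → Dec (Deleted A M x)
  Deleted? A M x = (x ∈ˢ? A) ×-dec ¬? (x ∈ˡ? verts M)

  deleteEdgesAt : Graph n → Subset n → Edges → Graph n
  deleteEdgesAt G A M = record
    { Adj = λ u v → Adj G u v × ¬ Deleted A M u × ¬ Deleted A M v
    ; sym = λ { (p , du , dv) → Graph.sym G p , dv , du }
    ; irrefl = λ { (p , _) → Graph.irrefl G p }
    ; adj? = λ u v → adj? G u v ×-dec (¬? (Deleted? A M u) ×-dec ¬? (Deleted? A M v))
    }

module Submission where

-- Deleting edges keeps A independent, so α(G') ≥ |A| = α(G); the content is
-- that every independent set S of G' has |S| ≤ α(G).
--
-- Call a ∈ A reachable if it ends an alternating path d, x₁, a₁, …, xₖ, aₖ = a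
-- starting at a vertex d of A ∖ V(M), where each xᵢ ∉ A is a G-neighbour of
-- aᵢ₋₁ and (xᵢ , aᵢ) ∈ M.  Flipping such a path re-routes M to a cross
-- matching of the same size that misses a; hence, by maximality of M, every
-- neighbour x ∉ A of a reachable vertex is covered by M.  The set Z of
-- reachable vertices contains A ∖ V(M), lies in A, and is closed: the M-partner
-- of any neighbour x ∉ A of Z lies in Z.
--
-- Given S independent in G', let X be the vertices outside A with a neighbour
-- in Z.  Then I = (S ∖ X) ∪ Z is independent in G, and sending each vertex of
-- S ∩ X to its M-partner (fixing the rest of S) is an injection S → I, so
-- |S| ≤ |I| ≤ α(G).

open import Defs hiding (sym)
open import Data.Nat using (ℕ; zero; suc; _≤_; _+_; z≤n; s≤s)
open import Data.Nat.Properties using (≤-trans; ≤-reflexive; ≤-antisym; suc-injective; +-suc; +-monoʳ-≤; m≤m+n; n≮n)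
open import Data.Fin using (Fin; suc) renaming (_≟_ to _≟ᶠ_)
import Data.Fin.Properties as Fin
open import Data.Fin.Subset using (Subset; _∈_; _∉_; ∣_∣; _-_; _⊆_; _⊂_; inside; outside)
open import Data.Fin.Subset.Properties using (_∈?_; _⊂?_; nonempty?; Empty-unique; ∣⊥∣≡0; ∣p∣≤n; ∣p∣≡n⇒p≡⊤; ∈⊤; p─⊥≡p; p─q⊆p; x∈p⇒∣p-x∣<∣p∣; x∈p∧x≢y⇒x∈p-y; p⊂q⇒∣p∣<∣q∣)
open import Data.Vec using (tabulate; _∷_) renaming (here to hereᵛ; there to thereᵛ)
open import Data.Vec.Properties using (lookup∘tabulate; []=⇒lookup; lookup⇒[]=)
open import Data.List using (List; []; _∷_; map; length)
open import Data.List.Properties using (map-∘; length-map)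
open import Data.List.Relation.Unary.All as All using (All; []; _∷_)
open import Data.List.Relation.Unary.All.Properties using (¬Any⇒All¬)
import Data.List.Relation.Unary.All.Properties as AllP
open import Data.List.Relation.Unary.Any as Any using (Any; here; there)
open import Data.List.Relation.Unary.Unique.Propositional using (Unique)
open import Data.List.Relation.Unary.AllPairs using ([]; _∷_)
open import Data.List.Relation.Binary.Disjoint.Propositional using (Disjoint)
open import Data.List.Membership.Propositional using (find; lose) renaming (_∈_ to _∈ˡ_; _∉_ to _∉ˡ_)
open import Data.List.Membership.Propositional.Properties using (∈-map⁺; ∈-map⁻)
import Data.List.Membership.DecPropositional as DecMembership
open import Data.Product using (_×_; _,_; ∃; proj₁; proj₂)
open import Data.Sum using (_⊎_; inj₁; inj₂)
open import Data.Empty using (⊥-elim)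
open import Relation.Nullary using (¬_; Dec; yes; no; does)
open import Relation.Nullary.Decidable using (_×-dec_; _⊎-dec_; ¬?; dec-true)
open import Relation.Binary.PropositionalEquality

private variable n : ℕ

select : {P : Fin n → Set} → (∀ x → Dec (P x)) → Subset n
select P? = tabulate (λ x → does (P? x))

∈-select⁺ : {P : Fin n → Set} (P? : ∀ x → Dec (P x)) {x : Fin n} → P x → x ∈ select P?
∈-select⁺ P? {x} px = lookup⇒[]= x _ (trans (lookup∘tabulate _ x) (dec-true (P? x) px))

∈-select⁻ : {P : Fin n → Set} (P? : ∀ x → Dec (P x)) {x : Fin n} → x ∈ select P? → P x
∈-select⁻ P? {x} x∈ with P? x | trans (sym (lookup∘tabulate _ x)) ([]=⇒lookup x∈)
... | yes px | _ = px
... | no _ | ()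

∣p∣≡1+∣p-x∣ : (p : Subset n) {x : Fin n} → x ∈ p → ∣ p ∣ ≡ suc ∣ p - x ∣
∣p∣≡1+∣p-x∣ (inside ∷ p) hereᵛ = cong suc (cong ∣_∣ (sym (p─⊥≡p p)))
∣p∣≡1+∣p-x∣ (inside ∷ p) (thereᵛ x∈p) = cong suc (∣p∣≡1+∣p-x∣ p x∈p)
∣p∣≡1+∣p-x∣ (outside ∷ p) (thereᵛ x∈p) = ∣p∣≡1+∣p-x∣ p x∈p

x∈p-y⇒x≢y : (p : Subset n) {x y : Fin n} → x ∈ p - y → x ≢ y
x∈p-y⇒x≢y (_ ∷ p) {suc x} {suc y} (thereᵛ x∈) refl = x∈p-y⇒x≢y p x∈ refl

injective⇒∣p∣≤∣q∣ : (f : Fin n → Fin n) (p q : Subset n)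
  → (∀ {x} → x ∈ p → f x ∈ q)
  → (∀ {x y} → x ∈ p → y ∈ p → f x ≡ f y → x ≡ y)
  → ∣ p ∣ ≤ ∣ q ∣
injective⇒∣p∣≤∣q∣ {n} f p q = bySize ∣ p ∣ p q refl
  where
  bySize : ∀ k (p q : Subset n) → ∣ p ∣ ≡ k
    → (∀ {x} → x ∈ p → f x ∈ q)
    → (∀ {x y} → x ∈ p → y ∈ p → f x ≡ f y → x ≡ y)
    → ∣ p ∣ ≤ ∣ q ∣
  bySize k p q size into inj with nonempty? p
  ... | no empty = ≤-trans (≤-reflexive (trans (cong ∣_∣ (Empty-unique empty)) (∣⊥∣≡0 n))) z≤n
  bySize zero p q size into inj | yes (x , x∈p) with () ← trans (sym (∣p∣≡1+∣p-x∣ p x∈p)) size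
  bySize (suc k) p q size into inj | yes (x , x∈p) =
    ≤-trans (≤-reflexive (∣p∣≡1+∣p-x∣ p x∈p)) (≤-trans (s≤s rest) (x∈p⇒∣p-x∣<∣p∣ (into x∈p)))
    where
    into′ : ∀ {y} → y ∈ p - x → f y ∈ q - f x
    into′ {y} y∈ = x∈p∧x≢y⇒x∈p-y (into (p─q⊆p p _ y∈))
                     (λ fy≡fx → x∈p-y⇒x≢y p y∈ (inj (p─q⊆p p _ y∈) x∈p fy≡fx))
    rest : ∣ p - x ∣ ≤ ∣ q - f x ∣
    rest = bySize k (p - x) (q - f x) (suc-injective (trans (sym (∣p∣≡1+∣p-x∣ p x∈p)) size))
             into′ (λ y∈ z∈ → inj (p─q⊆p p _ y∈) (p─q⊆p p _ z∈))

-- The closure of a subset under an inflationary operation, obtained by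
-- iterating until nothing new is added; n rounds suffice since each
-- productive round adds a point.
module Closure {n : ℕ} (step : Subset n → Subset n) (inflationary : ∀ Z → Z ⊆ step Z) where

  iterate : ℕ → Subset n → Subset n
  iterate zero Z = Z
  iterate (suc k) Z with Z ⊂? step Z
  ... | yes _ = iterate k (step Z)
  ... | no _ = Z

  iterate-⊇ : ∀ k Z → Z ⊆ iterate k Z
  iterate-⊇ zero Z x∈ = x∈
  iterate-⊇ (suc k) Z x∈ with Z ⊂? step Z
  ... | yes _ = iterate-⊇ k (step Z) (inflationary Z x∈)
  ... | no _ = x∈

  iterate-preserves : (Inv : Subset n → Set) → (∀ Z → Inv Z → Inv (step Z)) → ∀ k Z → Inv Z → Inv (iterate k Z)
  iterate-preserves Inv pres zero Z inv = inv
  iterate-preserves Inv pres (suc k) Z inv with Z ⊂? step Z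
  ... | yes _ = iterate-preserves Inv pres k (step Z) (pres Z inv)
  ... | no _ = inv

  ⊄⇒closed : ∀ Z → ¬ (Z ⊂ step Z) → step Z ⊆ Z
  ⊄⇒closed Z not⊂ {x} x∈ with x ∈? Z
  ... | yes x∈Z = x∈Z
  ... | no x∉Z = ⊥-elim (not⊂ (inflationary Z , x , x∈ , x∉Z))

  iterate-closed : ∀ k Z → n ≤ k + ∣ Z ∣ → step (iterate k Z) ⊆ iterate k Z
  iterate-closed zero Z n≤∣Z∣ {x} _ = subst (x ∈_) (sym (∣p∣≡n⇒p≡⊤ (≤-antisym (∣p∣≤n Z) n≤∣Z∣))) ∈⊤
  iterate-closed (suc k) Z bound with Z ⊂? step Z
  ... | yes Z⊂ = iterate-closed k (step Z)
                   (≤-trans bound (≤-trans (≤-reflexive (sym (+-suc k ∣ Z ∣))) (+-monoʳ-≤ k (p⊂q⇒∣p∣<∣q∣ Z⊂))))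
  ... | no not⊂ = ⊄⇒closed Z not⊂

  closure : Subset n → Subset n
  closure = iterate n

  closure-⊇ : ∀ Z → Z ⊆ closure Z
  closure-⊇ = iterate-⊇ n

  closure-closed : ∀ Z → step (closure Z) ⊆ closure Z
  closure-closed Z = iterate-closed n Z (m≤m+n n ∣ Z ∣)

  closure-preserves : (Inv : Subset n → Set) → (∀ Z → Inv Z → Inv (step Z)) → ∀ Z → Inv Z → Inv (closure Z)
  closure-preserves Inv pres = iterate-preserves Inv pres n

unique-map⇒injective : ∀ {a b} {B : Set a} {C : Set b} (f : B → C) {L : List B} {e e′ : B} →
  Unique (map f L) → e ∈ˡ L → e′ ∈ˡ L → f e ≡ f e′ → e ≡ e′
unique-map⇒injective f (_ ∷ _) (here refl) (here refl) _ = refl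
unique-map⇒injective f (fresh ∷ _) (here refl) (there e′∈) eq = ⊥-elim (All.lookup fresh (∈-map⁺ f e′∈) eq)
unique-map⇒injective f (fresh ∷ _) (there e∈) (here refl) eq = ⊥-elim (All.lookup fresh (∈-map⁺ f e∈) (sym eq))
unique-map⇒injective f (_ ∷ u) (there e∈) (there e′∈) eq = unique-map⇒injective f u e∈ e′∈ eq

redirect : Fin n → Fin n → Fin n → Fin n
redirect b a v with v ≟ᶠ b
... | yes _ = a
... | no _ = v

redirect-injective : ∀ (b a : Fin n) {v w} → a ≢ v → a ≢ w → redirect b a v ≡ redirect b a w → v ≡ w
redirect-injective b a {v} {w} a≢v a≢w eq with v ≟ᶠ b | w ≟ᶠ b
... | yes v≡b | yes w≡b = trans v≡b (sym w≡b)
... | yes _ | no _ = ⊥-elim (a≢w eq)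
... | no _ | yes _ = ⊥-elim (a≢v (sym eq))
... | no _ | no _ = eq

unique-redirect : ∀ {ℓ} {B : Set ℓ} (b a : Fin n) (h : B → Fin n) (L : List B) →
  Unique (map h L) → a ∉ˡ map h L → Unique (map (λ x → redirect b a (h x)) L)
unique-redirect b a h [] _ _ = []
unique-redirect b a h (x ∷ L) (fresh ∷ u) a∉ =
  All.tabulate (λ y∈ eq →
    let (y , y∈L , eq′) = ∈-map⁻ (λ x → redirect b a (h x)) y∈
    in All.lookup fresh (∈-map⁺ h y∈L)
         (redirect-injective b a (λ a≡ → a∉ (here a≡)) (λ a≡ → a∉ (there (subst (_∈ˡ map h L) (sym a≡) (∈-map⁺ h y∈L))))
           (trans eq eq′)))
  ∷ unique-redirect b a h L u (λ a∈ → a∉ (there a∈))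

∈-verts⁻ : (L : Edges {n}) {v : Fin n} → v ∈ˡ verts L → v ∈ˡ map proj₁ L ⊎ v ∈ˡ map proj₂ L
∈-verts⁻ (e ∷ L) (here refl) = inj₁ (here refl)
∈-verts⁻ (e ∷ L) (there (here refl)) = inj₂ (here refl)
∈-verts⁻ (e ∷ L) (there (there v∈)) with ∈-verts⁻ L v∈
... | inj₁ v∈₁ = inj₁ (there v∈₁)
... | inj₂ v∈₂ = inj₂ (there v∈₂)

∈-verts₁ : {L : Edges {n}} {v : Fin n} → v ∈ˡ map proj₁ L → v ∈ˡ verts L
∈-verts₁ {L = _ ∷ _} (here refl) = here refl
∈-verts₁ {L = _ ∷ _} (there v∈) = there (there (∈-verts₁ v∈))

∈-verts₂ : {L : Edges {n}} {v : Fin n} → v ∈ˡ map proj₂ L → v ∈ˡ verts L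
∈-verts₂ {L = _ ∷ _} (here refl) = there (here refl)
∈-verts₂ {L = _ ∷ _} (there v∈) = there (there (∈-verts₂ v∈))

unique-verts⁻ : (L : Edges {n}) → Unique (verts L) → Unique (map proj₁ L) × Unique (map proj₂ L)
unique-verts⁻ [] _ = [] , []
unique-verts⁻ (e ∷ L) ((_ ∷ fresh₁) ∷ (fresh₂ ∷ u)) =
  (All.tabulate (λ v∈ → All.lookup fresh₁ (∈-verts₁ v∈)) ∷ proj₁ (unique-verts⁻ L u)) ,
  (All.tabulate (λ v∈ → All.lookup fresh₂ (∈-verts₂ v∈)) ∷ proj₂ (unique-verts⁻ L u))

unique-verts⁺ : (L : Edges {n}) → Unique (map proj₁ L) → Unique (map proj₂ L) →
  Disjoint (map proj₁ L) (map proj₂ L) → Unique (verts L)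
unique-verts⁺ [] _ _ _ = []
unique-verts⁺ (e ∷ L) (fresh₁ ∷ u₁) (fresh₂ ∷ u₂) disjoint =
  ((λ eq → disjoint (here refl , here eq)) ∷ ¬Any⇒All¬ (verts L) first∉) ∷
  (¬Any⇒All¬ (verts L) second∉ ∷ unique-verts⁺ L u₁ u₂ (λ (v∈₁ , v∈₂) → disjoint (there v∈₁ , there v∈₂)))
  where
  first∉ : proj₁ e ∉ˡ verts L
  first∉ v∈ with ∈-verts⁻ L v∈
  ... | inj₁ v∈₁ = All.lookup fresh₁ v∈₁ refl
  ... | inj₂ v∈₂ = disjoint (here refl , there v∈₂)
  second∉ : proj₂ e ∉ˡ verts L
  second∉ v∈ with ∈-verts⁻ L v∈
  ... | inj₁ v∈₁ = disjoint (there v∈₁ , here refl)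
  ... | inj₂ v∈₂ = All.lookup fresh₂ v∈₂ refl

-- A list of A-crossing edges of G with distinct first and distinct second
-- ends is a cross matching: the two kinds of ends are separated by A.
crossMatching⁺ : (G : Graph n) (A : Subset n) (L : Edges {n}) →
  All (λ e → Adj G (proj₁ e) (proj₂ e) × proj₁ e ∉ A × proj₂ e ∈ A) L →
  Unique (map proj₁ L) → Unique (map proj₂ L) → CrossMatching G A L
crossMatching⁺ G A L crossing u₁ u₂ = crossing , unique-verts⁺ L u₁ u₂ separated
  where
  separated : Disjoint (map proj₁ L) (map proj₂ L)
  separated (v∈₁ , v∈₂) with ∈-map⁻ proj₁ v∈₁ | ∈-map⁻ proj₂ v∈₂
  ... | e , e∈ , refl | e′ , e′∈ , v≡ =
    proj₁ (proj₂ (All.lookup crossing e∈)) (subst (_∈ A) (sym v≡) (proj₂ (proj₂ (All.lookup crossing e′∈))))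

independent-after-deletion : (G : Graph n) (A : Subset n) (M : Edges {n}) (S : Subset n) →
  Independent G S → Independent (deleteEdgesAt G A M) S
independent-after-deletion G A M S indS u v u∈ v∈ (adj , _) = indS u v u∈ v∈ adj

module MaximumCrossMatchingFacts {n : ℕ} (G : Graph n) (A : Subset n) (M : Edges {n})
  (indA : Independent G A) (crossM : CrossMatching G A M)
  (maxM : ∀ M′ → CrossMatching G A M′ → length M′ ≤ length M) where

  open DecMembership (_≟ᶠ_ {n}) using () renaming (_∈?_ to _∈ˡ?_)

  G′ : Graph n
  G′ = deleteEdgesAt G A M

  edgesM : All (λ e → Adj G (proj₁ e) (proj₂ e) × proj₁ e ∉ A × proj₂ e ∈ A) M
  edgesM = proj₁ crossM

  firstsM-unique : Unique (map proj₁ M)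
  firstsM-unique = proj₁ (unique-verts⁻ M (proj₂ crossM))

  secondsM-unique : Unique (map proj₂ M)
  secondsM-unique = proj₂ (unique-verts⁻ M (proj₂ crossM))

  targets : (Fin n → Fin n) → List (Fin n)
  targets g = map (λ e → g (proj₂ e)) M

  -- AltPath a g: an alternating path from A ∖ V(M) ends at a, and flipping it
  -- moves the A-end of each M-edge (x , b) to g b.  Extending by an M-edge
  -- (x , b) with x adjacent to a and b not yet moved re-matches x to a.
  data AltPath : Fin n → (Fin n → Fin n) → Set where
    start  : ∀ {d} → d ∈ A → d ∉ˡ verts M → AltPath d (λ v → v)
    extend : ∀ {a g} (e : Fin n × Fin n) → AltPath a g → e ∈ˡ M → Adj G (proj₁ e) a →
             g (proj₂ e) ≡ proj₂ e → AltPath (proj₂ e) (λ v → redirect (proj₂ e) a (g v))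

  Reachable : Fin n → Set
  Reachable b = ∃ (AltPath b)

  -- Every A-end moved by the flip lies on the path, so is itself reachable.
  moved⇒reachable : ∀ {a g} → AltPath a g → ∀ c → g c ≢ c → Reachable c
  moved⇒reachable (start _ _) c moved = ⊥-elim (moved refl)
  moved⇒reachable {g = g′} path@(extend {g = g} e path′ _ _ _) c moved with g c ≟ᶠ proj₂ e
  ... | no _ = moved⇒reachable path′ c moved
  ... | yes gc≡b with c ≟ᶠ proj₂ e
  ...   | yes c≡b = subst Reachable (sym c≡b) (g′ , path)
  ...   | no c≢b = moved⇒reachable path′ c (λ gc≡c → c≢b (trans (sym gc≡c) gc≡b))

  -- Frees a g: re-routing M by g gives A-crossing edges of G with distinct
  -- A-ends, none of them a (a cross matching of size |M| missing a ∈ A).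
  record Frees (a : Fin n) (g : Fin n → Fin n) : Set where
    field
      a∈A      : a ∈ A
      rerouted : ∀ {e} → e ∈ˡ M → Adj G (proj₁ e) (g (proj₂ e)) × g (proj₂ e) ∈ A
      distinct : Unique (targets g)
      a-free   : a ∉ˡ targets g

  altPath⇒frees : ∀ {a g} → AltPath a g → Frees a g
  altPath⇒frees (start d∈A d∉M) = record
    { a∈A = d∈A
    ; rerouted = λ e∈ → let (adj , _ , b∈A) = All.lookup edgesM e∈ in adj , b∈A
    ; distinct = secondsM-unique
    ; a-free = λ d∈ → d∉M (∈-verts₂ d∈)
    }
  altPath⇒frees (extend {a} {g} e path e∈ adj fixed) = record
    { a∈A = proj₂ (proj₂ (All.lookup edgesM e∈))
    ; rerouted = rerouted′
    ; distinct = unique-redirect (proj₂ e) a (λ e → g (proj₂ e)) M distinct a-free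
    ; a-free = b-free
    }
    where
    open Frees (altPath⇒frees path)
    -- The only M-edge whose target is b = proj₂ e is e itself.
    rerouted′ : ∀ {e′} → e′ ∈ˡ M → Adj G (proj₁ e′) (redirect (proj₂ e) a (g (proj₂ e′))) × redirect (proj₂ e) a (g (proj₂ e′)) ∈ A
    rerouted′ {e′} e′∈ with g (proj₂ e′) ≟ᶠ proj₂ e
    ... | no _ = rerouted e′∈
    ... | yes ge′≡b =
      subst (λ x → Adj G (proj₁ x) a) (sym (unique-map⇒injective (λ e → g (proj₂ e)) distinct e′∈ e∈ (trans ge′≡b (sym fixed)))) adj ,
      a∈A
    b-free : proj₂ e ∉ˡ targets (λ v → redirect (proj₂ e) a (g v))
    b-free b∈ with ∈-map⁻ (λ x → redirect (proj₂ e) a (g (proj₂ x))) b∈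
    ... | e′ , e′∈ , eq with g (proj₂ e′) ≟ᶠ proj₂ e
    ...   | yes _ = a-free (subst (_∈ˡ targets g) (trans fixed eq) (∈-map⁺ (λ e → g (proj₂ e)) e∈))
    ...   | no ge′≢b = ge′≢b (sym eq)

  reachable-step : ∀ {z e} → Reachable z → e ∈ˡ M → Adj G (proj₁ e) z → Reachable (proj₂ e)
  reachable-step {e = e} (g , path) e∈ adj with g (proj₂ e) ≟ᶠ proj₂ e
  ... | yes fixed = _ , extend e path e∈ adj fixed
  ... | no moved = moved⇒reachable path (proj₂ e) moved

  -- By maximality of M, a neighbour x ∉ A of a freed vertex z is covered by M:
  -- otherwise the re-routed matching plus (x , z) is a larger cross matching.
  frees⇒neighbour-matched : ∀ {z g x} → Frees z g → x ∉ A → Adj G x z → x ∈ˡ map proj₁ M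
  frees⇒neighbour-matched {z} {g} {x} free x∉A adj with x ∈ˡ? map proj₁ M
  ... | yes x∈ = x∈
  ... | no x∉ = ⊥-elim (n≮n (length M) larger)
    where
    open Frees free
    reroute : Fin n × Fin n → Fin n × Fin n
    reroute e = proj₁ e , g (proj₂ e)
    M⁺ : Edges {n}
    M⁺ = (x , z) ∷ map reroute M
    firsts : map proj₁ (map reroute M) ≡ map proj₁ M
    firsts = sym (map-∘ M)
    seconds : map proj₂ (map reroute M) ≡ targets g
    seconds = sym (map-∘ M)
    crossing : All (λ e → Adj G (proj₁ e) (proj₂ e) × proj₁ e ∉ A × proj₂ e ∈ A) M⁺
    crossing = (adj , x∉A , a∈A) ∷ AllP.map⁺ (All.tabulate (λ e∈ →
      proj₁ (rerouted e∈) , proj₁ (proj₂ (All.lookup edgesM e∈)) , proj₂ (rerouted e∈)))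
    larger : suc (length M) ≤ length M
    larger = ≤-trans (≤-reflexive (cong suc (sym (length-map reroute M))))
      (maxM M⁺ (crossMatching⁺ G A M⁺ crossing
        (subst (λ L → Unique (x ∷ L)) (sym firsts)
          (¬Any⇒All¬ _ x∉ ∷ firstsM-unique))
        (subst (λ L → Unique (z ∷ L)) (sym seconds) (¬Any⇒All¬ _ a-free ∷ distinct))))

  EntersFrom : Subset n → Fin n → Set
  EntersFrom Z b = Any (λ e → proj₂ e ≡ b × ∃ λ z → z ∈ Z × Adj G (proj₁ e) z) M

  entersFrom? : (Z : Subset n) (b : Fin n) → Dec (EntersFrom Z b)
  entersFrom? Z b = Any.any? (λ e → (proj₂ e ≟ᶠ b) ×-dec Fin.any? (λ z → (z ∈? Z) ×-dec adj? G (proj₁ e) z)) M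

  grow? : (Z : Subset n) (b : Fin n) → Dec (b ∈ Z ⊎ EntersFrom Z b)
  grow? Z b = (b ∈? Z) ⊎-dec entersFrom? Z b

  grow : Subset n → Subset n
  grow Z = select (grow? Z)

  grow-inflationary : ∀ Z → Z ⊆ grow Z
  grow-inflationary Z b∈ = ∈-select⁺ (grow? Z) (inj₁ b∈)

  AllReachable : Subset n → Set
  AllReachable Z = ∀ {z} → z ∈ Z → Reachable z

  grow-reachable : ∀ Z → AllReachable Z → AllReachable (grow Z)
  grow-reachable Z reach b∈ with ∈-select⁻ (grow? Z) b∈
  ... | inj₁ b∈Z = reach b∈Z
  ... | inj₂ enters with find enters
  ...   | e , e∈ , refl , z , z∈ , adj = reachable-step (reach z∈) e∈ adj

  open Closure grow grow-inflationary

  Z : Subset n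
  Z = closure (select (Deleted? A M))

  Z-reachable : AllReachable Z
  Z-reachable = closure-preserves AllReachable grow-reachable _
    (λ d∈ → let (d∈A , d∉M) = ∈-select⁻ (Deleted? A M) d∈ in _ , start d∈A d∉M)

  Z⊆A : ∀ {z} → z ∈ Z → z ∈ A
  Z⊆A z∈ = Frees.a∈A (altPath⇒frees (proj₂ (Z-reachable z∈)))

  deleted∈Z : ∀ {d} → Deleted A M d → d ∈ Z
  deleted∈Z deleted = closure-⊇ _ (∈-select⁺ (Deleted? A M) deleted)

  Z-closed : ∀ {z x} → z ∈ Z → x ∉ A → Adj G x z → ∃ λ e → e ∈ˡ M × proj₁ e ≡ x × proj₂ e ∈ Z
  Z-closed {z} {x} z∈ x∉A adj with ∈-map⁻ proj₁ (frees⇒neighbour-matched (altPath⇒frees (proj₂ (Z-reachable z∈))) x∉A adj)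
  ... | e , e∈ , refl = e , e∈ , refl ,
    closure-closed _ (∈-select⁺ (grow? Z) (inj₂ (lose e∈ (refl , z , z∈ , adj))))

  -- Edges of M survive in G′: their ends are matched or lie outside A.
  M⊆G′ : ∀ {e} → e ∈ˡ M → Adj G′ (proj₁ e) (proj₂ e)
  M⊆G′ {e} e∈ = let (adj , x∉A , _) = All.lookup edgesM e∈ in
    adj , (λ deleted → x∉A (proj₁ deleted)) , (λ deleted → proj₂ deleted (∈-verts₂ (∈-map⁺ proj₂ e∈)))

  module _ (S : Subset n) (indS : Independent G′ S) where

    Outer : Fin n → Set
    Outer v = v ∉ A × ∃ λ z → z ∈ Z × Adj G v z

    outer? : (v : Fin n) → Dec (Outer v)
    outer? v = ¬? (v ∈? A) ×-dec Fin.any? (λ z → (z ∈? Z) ×-dec adj? G v z)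

    InI : Fin n → Set
    InI v = (v ∈ S × ¬ Outer v) ⊎ v ∈ Z

    inI? : (v : Fin n) → Dec (InI v)
    inI? v = ((v ∈? S) ×-dec ¬? (outer? v)) ⊎-dec (v ∈? Z)

    I : Subset n
    I = select inI?

    -- Z has no G-neighbour in I: within A by independence, outside A by definition of X.
    Z-isolated-in-I : ∀ {z w} → z ∈ Z → InI w → ¬ Adj G z w
    Z-isolated-in-I {z} {w} z∈ (inj₂ w∈Z) adj = indA z w (Z⊆A z∈) (Z⊆A w∈Z) adj
    Z-isolated-in-I {z} {w} z∈ (inj₁ (_ , not-outer)) adj with w ∈? A
    ... | yes w∈A = indA z w (Z⊆A z∈) w∈A adj
    ... | no w∉A = not-outer (w∉A , z , z∈ , Graph.sym G adj)

    -- Two vertices of S ∖ X are not G-adjacent: a G-edge between vertices of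
    -- S is deleted, so it touches A ∖ V(M) ⊆ Z.
    I-independent : Independent G I
    I-independent u v u∈ v∈ adj with ∈-select⁻ inI? u∈ | ∈-select⁻ inI? v∈
    ... | inj₂ u∈Z | v-in = Z-isolated-in-I u∈Z v-in adj
    ... | u-in | inj₂ v∈Z = Z-isolated-in-I v∈Z u-in (Graph.sym G adj)
    ... | inj₁ (u∈S , u-inner) | inj₁ (v∈S , v-inner) with Deleted? A M u | Deleted? A M v
    ...   | yes u-del | _ = Z-isolated-in-I (deleted∈Z u-del) (inj₁ (v∈S , v-inner)) adj
    ...   | no _ | yes v-del = Z-isolated-in-I (deleted∈Z v-del) (inj₁ (u∈S , u-inner)) (Graph.sym G adj)
    ...   | no u-kept | no v-kept = indS u v u∈S v∈S (adj , u-kept , v-kept)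

    partner : Fin n → Fin n
    partner v with outer? v
    ... | yes (v∉A , z , z∈ , adj) = proj₂ (proj₁ (Z-closed z∈ v∉A adj))
    ... | no _ = v

    partner-into : ∀ {v} → v ∈ S → partner v ∈ I
    partner-into {v} v∈S with outer? v
    ... | yes (v∉A , z , z∈ , adj) = ∈-select⁺ inI? (inj₂ (proj₂ (proj₂ (proj₂ (Z-closed z∈ v∉A adj)))))
    ... | no not-outer = ∈-select⁺ inI? (inj₁ (v∈S , not-outer))

    no-M-edge-in-S : ∀ {e} → e ∈ˡ M → proj₁ e ∈ S → proj₂ e ∉ S
    no-M-edge-in-S e∈ x∈S b∈S = indS _ _ x∈S b∈S (M⊆G′ e∈)

    partner-injective : ∀ {u v} → u ∈ S → v ∈ S → partner u ≡ partner v → u ≡ v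
    partner-injective {u} {v} u∈S v∈S eq with outer? u | outer? v
    ... | yes (u∉A , z , z∈ , adj) | yes (v∉A , z′ , z′∈ , adj′)
        with Z-closed z∈ u∉A adj | Z-closed z′∈ v∉A adj′
    ...   | e , e∈ , refl , _ | e′ , e′∈ , refl , _ = cong proj₁ (unique-map⇒injective proj₂ secondsM-unique e∈ e′∈ eq)
    partner-injective {u} {v} u∈S v∈S eq | yes (u∉A , z , z∈ , adj) | no _ with Z-closed z∈ u∉A adj
    ...   | e , e∈ , refl , _ = ⊥-elim (no-M-edge-in-S e∈ u∈S (subst (_∈ S) (sym eq) v∈S))
    partner-injective {u} {v} u∈S v∈S eq | no _ | yes (v∉A , z , z∈ , adj) with Z-closed z∈ v∉A adj
    ...   | e , e∈ , refl , _ = ⊥-elim (no-M-edge-in-S e∈ v∈S (subst (_∈ S) eq u∈S))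
    partner-injective u∈S v∈S eq | no _ | no _ = eq

    |S|≤|I| : ∣ S ∣ ≤ ∣ I ∣
    |S|≤|I| = injective⇒∣p∣≤∣q∣ partner S I partner-into partner-injective

  independent-in-G′-dominated : ∀ S → Independent G′ S → ∃ λ I → Independent G I × ∣ S ∣ ≤ ∣ I ∣
  independent-in-G′-dominated S indS = I S indS , I-independent S indS , |S|≤|I| S indS

lemma2p2 : {n : ℕ} (G : Graph n) (k : ℕ) (A : Subset n) (M : Edges {n})
    → IsIndependenceNumber G k
    → Independent G A → ∣ A ∣ ≡ k
    → MaximumCrossMatching G A M
    → IsIndependenceNumber (deleteEdgesAt G A M) k
lemma2p2 G k A M (_ , α-maximal) indA |A|≡k (crossM , maxM) =
  (A , independent-after-deletion G A M A indA , |A|≡k) ,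
  λ S indS → let (I , indI , |S|≤|I|) = independent-in-G′-dominated S indS
             in ≤-trans |S|≤|I| (α-maximal I indI)
  where open MaximumCrossMatchingFacts G A M indA crossM maxM
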